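{- Let $b\geq 2$ and $p\geq 2$ be natural numbers, and define $\phi_p:\mathbb{N}\to\mathbb{N}$ by $\phi_p(n)=(S_b(n))^p$. Then the set of natural numbers $n$ with $\phi_p(n)=n$ is finite. Moreover, if $\phi_p(n)=n$, then $n\leq b^{p^2}$.
   Context: For a natural number $n=\sum_{i=0}^{m-1}a_ib^i$ written in base $b$ (digits $0\le a_i\le b-1$), $S_b(n)=\sum_{i=0}^{m-1}a_i$ is its base-$b$ digit sum. -}

module Defs where

open import Data.Nat using (ℕ; zero; suc; _+_; _^_; _%_; _/_; NonZero)

digitSumAux : (b : ℕ) .{{_ : NonZero b}} → ℕ → ℕ → ℕ
digitSumAux b zero    n = 0
digitSumAux b (suc f) zero = 0
digitSumAux b (suc f) n@(suc _) = n % b + digitSumAux b f (n / b)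

-- S_b(n): the sum of the base-b digits of n  (fuel n suffices for b ≥ 2)
S : (b : ℕ) .{{_ : NonZero b}} → ℕ → ℕ
S b n = digitSumAux b n n

φ : (b p : ℕ) .{{_ : NonZero b}} → ℕ → ℕ
φ b p n = S b n ^ p

{-# OPTIONS --safe #-}
-- Write s = S_b(n), so a fixed point n = s^p satisfies s = S_b(s^p).  If s has m + 1
-- digits then s^p has at most p(m + 1) digits, hence s = S_b(s^p) ≤ (b - 1)p(m + 1).
-- Once (b - 1)p(M + 1) < b^M the same holds for every m ≥ M (the left side at most
-- doubles, the right side at least doubles), contradicting b^m ≤ s; so s < b^M.
-- For M = p this gives n = s^p < b^(p²).  This choice of M fails only for
-- (b, p) ∈ {(2,2), (2,3), (2,4), (3,2), (4,2)}, where a larger M works and the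
-- candidates s < b^M are checked by evaluation.  The base is written suc a throughout,
-- so a = b - 1 is the largest digit.

module Submission where

open import Defs
open import Data.Nat using (ℕ; _≤_; _^_; _*_; NonZero)
open import Data.List using (List)
open import Data.List.Membership.Propositional using (_∈_)
open import Data.Product using (Σ; _×_)
open import Relation.Binary.PropositionalEquality using (_≡_)

open import Data.Nat using (zero; suc; _+_; _<_; _≤′_; ≤′-refl; ≤′-step; _%_; _/_; z≤n; s≤s; z<s; >-nonZero)
open import Data.Nat.DivMod using (m%n<n; m<n*o⇒m/o<n)
open import Data.Nat.Properties
open import Algebra.Properties.CommutativeSemigroup *-commutativeSemigroup using (x∙yz≈y∙xz)
open import Data.Nat.Tactic.RingSolver using (solve-∀)
open import Data.List using (upTo)
open import Data.List.Membership.Propositional.Properties using (∈-upTo⁺)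
open import Data.Product using (_,_)
open import Relation.Binary.PropositionalEquality using (cong; subst)
open import Relation.Nullary using (Dec; yes; no; contradiction)
open import Relation.Nullary.Decidable using (True; toWitness; _→-dec_)

decide-< : ∀ {m n} → True (m <? n) → m < n
decide-< = toWitness

k+n≤2*n : ∀ {k n} → k ≤ n → k + n ≤ 2 * n
k+n≤2*n {k} {n} k≤n = begin
  k + n        ≤⟨ +-monoˡ-≤ n k≤n ⟩
  n + n        ≡⟨ cong (n +_) (+-identityʳ n) ⟨
  2 * n        ∎
  where open ≤-Reasoning

*-double : ∀ x {y z} → y ≤ 2 * z → x * y ≤ 2 * (x * z)
*-double x {y} {z} y≤2z = begin
  x * y       ≤⟨ *-monoʳ-≤ x y≤2z ⟩
  x * (2 * z) ≡⟨ x∙yz≈y∙xz x 2 z ⟩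
  2 * (x * z) ∎
  where open ≤-Reasoning

module _ {b : ℕ} (2≤b : 2 ≤ b) where

  n<b^n : ∀ n → n < b ^ n
  n<b^n zero    = s≤s z≤n
  n<b^n (suc n) = begin-strict
    suc n      ≤⟨ n<b^n n ⟩
    b ^ n      <⟨ m<m*n (b ^ n) b {{>-nonZero (<-≤-trans z<s (n<b^n n))}} 2≤b ⟩
    b ^ n * b  ≡⟨ *-comm (b ^ n) b ⟩
    b ^ suc n  ∎
    where open ≤-Reasoning

  doubling : (f : ℕ → ℕ) {M : ℕ} → (∀ {m} → M ≤ m → f (suc m) ≤ 2 * f m) →
             f M < b ^ M → ∀ {m} → M ≤ m → f m < b ^ m
  doubling f {M} step fM<b^M M≤m = go (≤⇒≤′ M≤m)
    where
    open ≤-Reasoning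
    go : ∀ {m} → M ≤′ m → f m < b ^ m
    go ≤′-refl = fM<b^M
    go {suc m} (≤′-step M≤′m) = begin-strict
      f (suc m)  ≤⟨ step (≤′⇒≤ M≤′m) ⟩
      2 * f m    <⟨ *-monoʳ-< 2 (go M≤′m) ⟩
      2 * b ^ m  ≤⟨ *-monoˡ-≤ (b ^ m) 2≤b ⟩
      b ^ suc m  ∎

digitSumAux≤a*k : ∀ a f {k n} → n < suc a ^ k → digitSumAux (suc a) f n ≤ a * k
digitSumAux≤a*k a zero    _ = z≤n
digitSumAux≤a*k a (suc f) {n = zero} _ = z≤n
digitSumAux≤a*k a (suc f) {zero}  {suc n} (s≤s ())
digitSumAux≤a*k a (suc f) {suc k} {suc n} n<b^[1+k] = begin
  suc n % b + digitSumAux b f (suc n / b)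
    ≤⟨ +-mono-≤ (≤-pred (m%n<n (suc n) b)) (digitSumAux≤a*k a f (m<n*o⇒m/o<n n<b^k*b)) ⟩
  a + a * k
    ≡⟨ *-suc a k ⟨
  a * suc k ∎
  where
  open ≤-Reasoning
  b = suc a
  n<b^k*b : suc n < b ^ k * b
  n<b^k*b = subst (suc n <_) (*-comm b (b ^ k)) n<b^[1+k]

PowBounded : ℕ → ℕ → ℕ → Set
PowBounded a p s = S (suc a) (s ^ p) ≡ s → s ^ p ≤ suc a ^ (p * p)

powBounded? : ∀ a p s → Dec (PowBounded a p s)
powBounded? a p s = (S (suc a) (s ^ p) ≟ s) →-dec (s ^ p ≤? suc a ^ (p * p))

module _ (a p : ℕ) .{{_ : NonZero p}} where

  private
    b : ℕ
    b = suc a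

  fixedPoint-digitBound : ∀ {s} k → S b (s ^ p) ≡ s → s < b ^ k → s ≤ a * (p * k)
  fixedPoint-digitBound {s} k fixed s<b^k = subst (_≤ a * (p * k)) fixed (digitSumAux≤a*k a (s ^ p) s^p<b^[p*k])
    where
    open ≤-Reasoning
    s^p<b^[p*k] : s ^ p < b ^ (p * k)
    s^p<b^[p*k] = begin-strict
      s ^ p        <⟨ ^-monoˡ-< p s<b^k ⟩
      (b ^ k) ^ p  ≡⟨ ^-*-assoc b k p ⟩
      b ^ (k * p)  ≡⟨ cong (b ^_) (*-comm k p) ⟩
      b ^ (p * k)  ∎

  digitBound-eventually : 1 ≤ a → ∀ {M} → a * (p * suc M) < b ^ M → ∀ {m} → M ≤ m → a * (p * suc m) < b ^ m
  digitBound-eventually 1≤a = doubling (s≤s 1≤a) (λ m → a * (p * suc m))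
    (λ {m} _ → *-double a (*-double p (k+n≤2*n {1} {suc m} (s≤s z≤n))))

  fixedPoint<b^M : 1 ≤ a → ∀ {M} → a * (p * suc M) < b ^ M → ∀ {s} → S b (s ^ p) ≡ s → s < b ^ M
  fixedPoint<b^M 1≤a {M} base {s} fixed = below s (n<b^n (s≤s 1≤a) s)
    where
    below : ∀ j → s < b ^ j → s < b ^ M
    below zero    (s≤s z≤n) = m^n>0 b M
    below (suc m) s<b^[1+m] with M ≤? m
    ... | no M≰m = <-≤-trans s<b^[1+m] (^-monoʳ-≤ b (≰⇒> M≰m))
    ... | yes M≤m with s <? b ^ m
    ...   | yes s<b^m = below m s<b^m
    ...   | no s≮b^m  = contradiction (fixedPoint-digitBound (suc m) fixed s<b^[1+m])
                          (<⇒≱ (<-≤-trans (digitBound-eventually 1≤a base M≤m) (≮⇒≥ s≮b^m)))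

  powBounded : 1 ≤ a → a * (p * suc p) < b ^ p → ∀ s → PowBounded a p s
  powBounded 1≤a base s fixed = begin
    s ^ p        ≤⟨ ^-monoˡ-≤ p (<⇒≤ (fixedPoint<b^M 1≤a base fixed)) ⟩
    (b ^ p) ^ p  ≡⟨ ^-*-assoc b p p ⟩
    b ^ (p * p)  ∎
    where open ≤-Reasoning

  powBounded-byExhaustion : 1 ≤ a → ∀ M → a * (p * suc M) < b ^ M →
                            True (allUpTo? (powBounded? a p) (b ^ M)) → ∀ s → PowBounded a p s
  powBounded-byExhaustion 1≤a M base checked s fixed = toWitness checked (fixedPoint<b^M 1≤a base fixed) fixed

diagonalBound-eventually : ∀ {a p₀} → 1 ≤ a → 2 ≤ p₀ → a * (p₀ * suc p₀) < suc a ^ p₀ →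
                           ∀ {p} → p₀ ≤ p → a * (p * suc p) < suc a ^ p
diagonalBound-eventually {a} {p₀} 1≤a 2≤p₀ = doubling (s≤s 1≤a) (λ q → a * (q * suc q)) step
  where
  step : ∀ {q} → p₀ ≤ q → a * (suc q * suc (suc q)) ≤ 2 * (a * (q * suc q))
  step {q} p₀≤q = *-double a (begin
    suc q * suc (suc q)  ≡⟨ *-comm (suc q) (suc (suc q)) ⟩
    suc (suc q) * suc q  ≤⟨ *-monoˡ-≤ (suc q) (k+n≤2*n (≤-trans 2≤p₀ p₀≤q)) ⟩
    2 * q * suc q        ≡⟨ *-assoc 2 q (suc q) ⟩
    2 * (q * suc q)      ∎)
    where open ≤-Reasoning

diagonalBound-at-2 : ∀ {a} → 4 ≤ a → a * (2 * 3) < suc a ^ 2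
diagonalBound-at-2 {a} 4≤a = begin-strict
  a * (2 * 3)          ≡⟨ expand-6a a ⟩
  4 * a + 2 * a        ≤⟨ +-monoˡ-≤ (2 * a) (*-monoˡ-≤ a 4≤a) ⟩
  a * a + 2 * a        <⟨ n<1+n (a * a + 2 * a) ⟩
  suc (a * a + 2 * a)  ≡⟨ expand-square a ⟩
  suc a ^ 2            ∎
  where
  open ≤-Reasoning
  expand-6a : ∀ a → a * (2 * 3) ≡ 4 * a + 2 * a
  expand-6a = solve-∀
  expand-square : ∀ a → suc (a * a + 2 * a) ≡ suc a * (suc a * 1)
  expand-square = solve-∀

powBounded-all : ∀ a p → 1 ≤ a → 2 ≤ p → ∀ s → PowBounded a p s
powBounded-all _ 0 _ ()
powBounded-all _ 1 _ (s≤s ())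
powBounded-all 1 2 1≤a _ = powBounded-byExhaustion 1 2 1≤a 4 (decide-< _) _
powBounded-all 1 3 1≤a _ = powBounded-byExhaustion 1 3 1≤a 5 (decide-< _) _
powBounded-all 1 4 1≤a _ = powBounded-byExhaustion 1 4 1≤a 5 (decide-< _) _
powBounded-all 1 p@(suc (suc (suc (suc (suc q))))) 1≤a _ =
  powBounded 1 p 1≤a (diagonalBound-eventually 1≤a (s≤s (s≤s z≤n)) (decide-< _) (m≤m+n 5 q))
powBounded-all 2 2 1≤a _ = powBounded-byExhaustion 2 2 1≤a 3 (decide-< _) _
powBounded-all 2 p@(suc (suc (suc q))) 1≤a _ =
  powBounded 2 p 1≤a (diagonalBound-eventually 1≤a (s≤s (s≤s z≤n)) (decide-< _) (m≤m+n 3 q))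
powBounded-all 3 2 1≤a _ = powBounded-byExhaustion 3 2 1≤a 3 (decide-< _) _
powBounded-all 3 p@(suc (suc (suc q))) 1≤a _ =
  powBounded 3 p 1≤a (diagonalBound-eventually 1≤a (s≤s (s≤s z≤n)) (decide-< _) (m≤m+n 3 q))
powBounded-all a@(suc (suc (suc (suc d)))) p@(suc (suc q)) 1≤a _ =
  powBounded a p 1≤a (diagonalBound-eventually 1≤a (s≤s (s≤s z≤n)) (diagonalBound-at-2 (m≤m+n 4 d)) (m≤m+n 2 q))

theorem6p1 : (b p : ℕ) → .{{_ : NonZero b}} → 2 ≤ b → 2 ≤ p →
    (Σ (List ℕ) λ L → ∀ n → φ b p n ≡ n → n ∈ L)
    × (∀ n → φ b p n ≡ n → n ≤ b ^ (p * p))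
theorem6p1 (suc a) p (s≤s 1≤a) 2≤p = (upTo (suc (suc a ^ (p * p))) , λ n fixed → ∈-upTo⁺ (s≤s (bound n fixed))) , bound
  where
  bound : ∀ n → φ (suc a) p n ≡ n → n ≤ suc a ^ (p * p)
  bound n fixed = subst (_≤ suc a ^ (p * p)) fixed (powBounded-all a p 1≤a 2≤p (S (suc a) n) (cong (S (suc a)) fixed))
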